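{- A Turing degree $\mathbf{d}$ is low for embeddings if and only if it is low for bi-embeddings.
   Context: A Turing degree $\mathbf{d}$ is low for embeddings if for all computable structures $\mathcal{A},\mathcal{B}$: whenever there is a $\mathbf{d}$-computable isomorphic embedding $f\colon\mathcal{A}\hookrightarrow\mathcal{B}$, there is a computable isomorphic embedding $g\colon\mathcal{A}\hookrightarrow\mathcal{B}$. Write $\mathcal{A}\approx_{\mathbf{d}}\mathcal{B}$ if there are $\mathbf{d}$-computable isomorphic embeddings $\mathcal{A}\hookrightarrow\mathcal{B}$ and $\mathcal{B}\hookrightarrow\mathcal{A}$. A degree $\mathbf{d}$ is low for bi-embeddings if for all computable structures $\mathcal{A},\mathcal{B}$: $\mathcal{A}\approx_{\mathbf{d}}\mathcal{B}$ implies $\mathcal{A}\approx_{\mathbf{0}}\mathcal{B}$. -}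

module Defs where

open import Data.Nat using (ℕ; zero; suc; _+_; _*_; _<_)
open import Data.Nat.DivMod using (_/_)
open import Data.Bool using (Bool; true; false)
open import Data.Fin using (Fin)
open import Data.Vec using (Vec; []; _∷_; lookup; map)
open import Data.Vec.Relation.Unary.All using (All)
open import Data.Product using (Σ; ∃; _×_)
open import Relation.Binary.PropositionalEquality using (_≡_)

-- Oracle computation: Kleene's partial recursive functions with an
-- oracle X : ℕ → Bool (equivalent to oracle Turing machines).

Oracle : Set
Oracle = ℕ → Bool

b2n : Bool → ℕ
b2n true  = 1
b2n false = 0

-- the empty oracle (computability = computability relative to ∅)
∅ : Oracle
∅ _ = false

data Code : ℕ → Set where
  zer  : ∀ {n} → Code n
  sc   : Code 1
  proj : ∀ {n} → Fin n → Code n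
  orc  : Code 1
  comp : ∀ {n m} → Code m → Vec (Code n) m → Code n
  prec : ∀ {n} → Code n → Code (suc (suc n)) → Code (suc n)
  mu   : ∀ {n} → Code (suc n) → Code n

mutual
  data Eval (X : Oracle) : ∀ {n} → Code n → Vec ℕ n → ℕ → Set where
    e-zer  : ∀ {n} {xs : Vec ℕ n} → Eval X zer xs 0
    e-sc   : ∀ {x} → Eval X sc (x ∷ []) (suc x)
    e-proj : ∀ {n} {i : Fin n} {xs} → Eval X (proj i) xs (lookup xs i)
    e-orc  : ∀ {x} → Eval X orc (x ∷ []) (b2n (X x))
    e-comp : ∀ {n m} {f : Code m} {gs : Vec (Code n) m} {xs ys y} →
             EvalAll X gs xs ys → Eval X f ys y → Eval X (comp f gs) xs y
    e-prec0 : ∀ {n} {g : Code n} {h} {xs y} →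
              Eval X g xs y → Eval X (prec g h) (0 ∷ xs) y
    e-precS : ∀ {n} {g : Code n} {h} {k xs r y} →
              Eval X (prec g h) (k ∷ xs) r → Eval X h (k ∷ r ∷ xs) y →
              Eval X (prec g h) (suc k ∷ xs) y
    e-mu   : ∀ {n} {f : Code (suc n)} {xs y} →
             Eval X f (y ∷ xs) 0 →
             (∀ z → z < y → ∃ λ k → Eval X f (z ∷ xs) (suc k)) →
             Eval X (mu f) xs y

  data EvalAll (X : Oracle) {n : ℕ} : ∀ {m} → Vec (Code n) m → Vec ℕ n → Vec ℕ m → Set where
    []  : ∀ {xs} → EvalAll X [] xs []
    _∷_ : ∀ {m} {g} {gs : Vec (Code n) m} {xs y ys} →
          Eval X g xs y → EvalAll X gs xs ys → EvalAll X (g ∷ gs) xs (y ∷ ys)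

Computable : Oracle → (ℕ → ℕ) → Set
Computable X f = Σ (Code 1) λ e → ∀ n → Eval X e (n ∷ []) (f n)

-- Coding of finite tuples by natural numbers (Cantor pairing)

pair : ℕ → ℕ → ℕ
pair a b = ((a + b) * suc (a + b)) / 2 + b

code : ∀ {n} → Vec ℕ n → ℕ
code []       = 0
code (x ∷ xs) = suc (pair x (code xs))

-- Computable languages: relation symbols and function symbols (constants
-- are 0-ary function symbols), each a computable set of natural numbers,
-- with computable arity functions.

record Language : Set where
  field
    isRel : ℕ → Bool
    isFun : ℕ → Bool
    rar   : ℕ → ℕ
    far   : ℕ → ℕ
    isRel-comp : Computable ∅ (λ r → b2n (isRel r))
    isFun-comp : Computable ∅ (λ f → b2n (isFun f))
    rar-comp   : Computable ∅ rar
    far-comp   : Computable ∅ far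

record Structure (L : Language) : Set where
  open Language L
  field
    dom      : ℕ → Bool
    nonempty : ∃ λ a → dom a ≡ true
    Rel      : (r : ℕ) → Vec ℕ (rar r) → Bool
    Fun      : (f : ℕ) → Vec ℕ (far f) → ℕ
    Fun-closed : ∀ f → isFun f ≡ true → ∀ xs → All (λ a → dom a ≡ true) xs →
                 dom (Fun f xs) ≡ true

record IsComputable {L : Language} (A : Structure L) : Set where
  open Language L
  open Structure A
  field
    dom-comp : Computable ∅ (λ a → b2n (dom a))
    rel-comp : Σ (Code 2) λ e → ∀ r → isRel r ≡ true → ∀ xs →
               All (λ a → dom a ≡ true) xs →
               Eval ∅ e (r ∷ code xs ∷ []) (b2n (Rel r xs))
    fun-comp : Σ (Code 2) λ e → ∀ f → isFun f ≡ true → ∀ xs →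
               All (λ a → dom a ≡ true) xs →
               Eval ∅ e (f ∷ code xs ∷ []) (Fun f xs)

record CompStructure (L : Language) : Set where
  field
    struct : Structure L
    isComp : IsComputable struct

record IsEmbedding {L : Language} (A B : Structure L) (h : ℕ → ℕ) : Set where
  open Language L
  module A = Structure A
  module B = Structure B
  field
    pres-dom : ∀ a → A.dom a ≡ true → B.dom (h a) ≡ true
    injective : ∀ a b → A.dom a ≡ true → A.dom b ≡ true → h a ≡ h b → a ≡ b
    pres-rel : ∀ r → isRel r ≡ true → ∀ xs → All (λ a → A.dom a ≡ true) xs →
               A.Rel r xs ≡ B.Rel r (map h xs)
    pres-fun : ∀ f → isFun f ≡ true → ∀ xs → All (λ a → A.dom a ≡ true) xs →
               h (A.Fun f xs) ≡ B.Fun f (map h xs)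

_↪[_]_ : {L : Language} → CompStructure L → Oracle → CompStructure L → Set
_↪[_]_ {L} A X B =
  Σ (ℕ → ℕ) λ h → IsEmbedding (CompStructure.struct A) (CompStructure.struct B) h ×
    Σ (Code 1) λ e → ∀ a → Structure.dom (CompStructure.struct A) a ≡ true →
                      Eval X e (a ∷ []) (h a)

_≈[_]_ : {L : Language} → CompStructure L → Oracle → CompStructure L → Set
A ≈[ X ] B = (A ↪[ X ] B) × (B ↪[ X ] A)

LowForEmbeddings : Oracle → Set
LowForEmbeddings X = ∀ (L : Language) (A B : CompStructure L) →
  A ↪[ X ] B → A ↪[ ∅ ] B

LowForBiEmbeddings : Oracle → Set
LowForBiEmbeddings X = ∀ (L : Language) (A B : CompStructure L) →
  A ≈[ X ] B → A ≈[ ∅ ] B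

module Submission where

open import Defs
open import Data.Product using (_×_; _,_; proj₁)

-- A bi-embedding is a pair of embeddings, which gives one direction.  For
-- the other, let f : A ↪ B be X-computable.  Over a relational language L'
-- (the relations of L, the graphs of its functions, and "same component")
-- form the disjoint union P ⊔ Q of one copy of P (component 0) and copies
-- of Q (components 1, 2, …), elements being Cantor pairs ⟨component, a⟩.
-- Then A ⊔ B ≈_X B ⊔ B via f ⊔ id and the shift of components, so lowness
-- gives a computable g : A ⊔ B ↪ B ⊔ B; preserving "same component", g maps
-- the copy of A into one copy of B, and second coordinates give A ↪ B.

-- (1) Cantor pairing.  The definition  pair  of Defs divides by two; we work
-- with the division-free form  cantor a b = tri (a + b) + b  and decode by
-- locating the diagonal  a + b  of a code.

module Pairing where

  open import Data.Nat
  open import Data.Nat.Properties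
  open import Data.Nat.Tactic.RingSolver using (solve-∀)
  open import Data.Nat.DivMod using (_/_; m*n/n≡m)
  open import Data.Product using (proj₂)
  open import Relation.Binary.PropositionalEquality
  open import Data.Empty using (⊥-elim)
  open import Relation.Binary.Definitions using (tri<; tri≈; tri>)

  tri : ℕ → ℕ
  tri zero = zero
  tri (suc k) = tri k + suc k

  cantor : ℕ → ℕ → ℕ
  cantor a b = tri (a + b) + b

  tri-double : ∀ n → n * suc n ≡ tri n * 2
  tri-double zero = refl
  tri-double (suc n) = begin
    suc n * suc (suc n)       ≡⟨ expand n ⟩
    2 * suc n + n * suc n     ≡⟨ cong (2 * suc n +_) (tri-double n) ⟩
    2 * suc n + tri n * 2     ≡⟨ regroup n (tri n) ⟩
    (tri n + suc n) * 2       ∎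
    where
    open ≡-Reasoning
    expand : ∀ n → suc n * suc (suc n) ≡ 2 * suc n + n * suc n
    expand = solve-∀
    regroup : ∀ n t → 2 * suc n + t * 2 ≡ (t + suc n) * 2
    regroup = solve-∀

  pair≡cantor : ∀ a b → pair a b ≡ cantor a b
  pair≡cantor a b = cong (_+ b) (trans (cong (_/ 2) (tri-double (a + b))) (m*n/n≡m (tri (a + b)) 2))

  -- the enumeration of ℕ × ℕ along diagonals; it inverts  cantor
  unpair : ℕ → ℕ × ℕ
  unpair zero = 0 , 0
  unpair (suc z) = next (proj₁ (unpair z)) (proj₂ (unpair z))
    where
    next : ℕ → ℕ → ℕ × ℕ
    next zero b = suc b , 0
    next (suc a) b = a , suc b

  diag : ℕ → ℕ
  diag z = proj₁ (unpair z) + proj₂ (unpair z)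

  unpair-inverse : ∀ z → tri (diag z) + proj₂ (unpair z) ≡ z
  unpair-inverse zero = refl
  unpair-inverse (suc z) with proj₁ (unpair z) | proj₂ (unpair z) | unpair-inverse z
  ... | zero | b | e = trans (+-identityʳ _) (trans (cong tri (+-identityʳ (suc b))) (trans (+-suc (tri b) b) (cong suc e)))
  ... | suc a | b | e = trans (cong (λ t → tri t + suc b) (+-suc a b))
                         (trans (+-suc (tri (suc a + b)) b) (cong suc e))

  unpair-π₂≤diag : ∀ z → proj₂ (unpair z) ≤ diag z
  unpair-π₂≤diag z = m≤n+m (proj₂ (unpair z)) (proj₁ (unpair z))

  -- the projections, in the form computed by the programs below
  π₂ : ℕ → ℕ
  π₂ z = z ∸ tri (diag z)

  π₁ : ℕ → ℕ
  π₁ z = diag z ∸ π₂ z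

  π₂≡unpair : ∀ z → π₂ z ≡ proj₂ (unpair z)
  π₂≡unpair z = trans (cong (_∸ tri (diag z)) (sym (unpair-inverse z))) (m+n∸m≡n (tri (diag z)) _)

  π₁≡unpair : ∀ z → π₁ z ≡ proj₁ (unpair z)
  π₁≡unpair z = trans (cong (diag z ∸_) (π₂≡unpair z)) (m+n∸n≡m (proj₁ (unpair z)) (proj₂ (unpair z)))

  tri-mono : ∀ {m n} → m ≤ n → tri m ≤ tri n
  tri-mono {m} m≤n with m≤n⇒∃[o]m+o≡n m≤n
  ... | o , refl = grow o
    where
    grow : ∀ o → tri m ≤ tri (m + o)
    grow zero = ≤-reflexive (cong tri (sym (+-identityʳ m)))
    grow (suc o) = ≤-trans (grow o) (≤-trans (m≤m+n (tri (m + o)) (suc (m + o)))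
                     (≤-reflexive (cong tri (sym (+-suc m o)))))

  tri-lt : ∀ s b → b ≤ s → tri s + b < tri (suc s)
  tri-lt s b b≤s = +-monoʳ-< (tri s) (s≤s b≤s)

  tri-uniq : ∀ s b s' b' → b ≤ s → b' ≤ s' → tri s + b ≡ tri s' + b' → s ≡ s'
  tri-uniq s b s' b' h h' e with <-cmp s s'
  ... | tri≈ _ p _ = p
  ... | tri< p _ _ = ⊥-elim (<-irrefl e (≤-trans (tri-lt s b h) (≤-trans (tri-mono p) (m≤m+n _ b'))))
  ... | tri> _ _ p = ⊥-elim (<-irrefl (sym e) (≤-trans (tri-lt s' b' h') (≤-trans (tri-mono p) (m≤m+n _ b))))

  diag-cantor : ∀ a b → diag (cantor a b) ≡ a + b
  diag-cantor a b = tri-uniq (diag z) (proj₂ (unpair z)) (a + b) b (unpair-π₂≤diag z) (m≤n+m b a) (unpair-inverse z)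
    where z = cantor a b

  π₂-cantor : ∀ a b → π₂ (cantor a b) ≡ b
  π₂-cantor a b = trans (cong (λ t → cantor a b ∸ tri t) (diag-cantor a b)) (m+n∸m≡n (tri (a + b)) b)

  π₁-cantor : ∀ a b → π₁ (cantor a b) ≡ a
  π₁-cantor a b = trans (cong₂ _∸_ (diag-cantor a b) (π₂-cantor a b)) (m+n∸n≡m a b)

  cantor-π : ∀ z → cantor (π₁ z) (π₂ z) ≡ z
  cantor-π z = trans (cong₂ (λ x y → tri (x + y) + y) (π₁≡unpair z) (π₂≡unpair z)) (unpair-inverse z)

  π-injective : ∀ {z z'} → π₁ z ≡ π₁ z' → π₂ z ≡ π₂ z' → z ≡ z'
  π-injective {z} {z'} e₁ e₂ = trans (sym (cantor-π z)) (trans (cong₂ cantor e₁ e₂) (cantor-π z'))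

  -- the diagonal of z is the least t with  suc z ≤ tri (suc t); this justifies
  -- computing it by unbounded search
  diag-stop : ∀ z → suc z ∸ tri (suc (diag z)) ≡ 0
  diag-stop z = m≤n⇒m∸n≡0 (≤-trans (≤-reflexive (cong suc (sym (unpair-inverse z))))
                  (tri-lt (diag z) _ (unpair-π₂≤diag z)))

  diag-continue : ∀ z t → t < diag z → suc z ∸ tri (suc t) ≡ suc (z ∸ tri (suc t))
  diag-continue z t t<r = +-∸-assoc 1 (≤-trans (tri-mono t<r) (≤-trans (m≤m+n _ _) (≤-reflexive (unpair-inverse z))))

  π₂≤cantor : ∀ a b → b ≤ cantor a b
  π₂≤cantor a b = m≤n+m b (tri (a + b))

module BoolFacts where

  open import Data.Nat using (ℕ; zero; suc; _≡ᵇ_)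
  open import Data.Nat.Properties using (≡ᵇ⇒≡; _≟_)
  open import Data.Bool using (true; false; _∧_; not; if_then_else_; T)
  open import Relation.Nullary using (yes; no; ¬_; contradiction)
  open import Relation.Binary.PropositionalEquality

  ≡ᵇ-true : ∀ {m n} → (m ≡ᵇ n) ≡ true → m ≡ n
  ≡ᵇ-true {m} {n} e = ≡ᵇ⇒≡ m n (subst T (sym e) _)

  ≡ᵇ-refl : ∀ m → (m ≡ᵇ m) ≡ true
  ≡ᵇ-refl zero = refl
  ≡ᵇ-refl (suc m) = ≡ᵇ-refl m

  ≡ᵇ-false : ∀ m n → ¬ m ≡ n → (m ≡ᵇ n) ≡ false
  ≡ᵇ-false m n m≢n with m ≡ᵇ n in eq
  ... | true = contradiction (≡ᵇ-true eq) m≢n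
  ... | false = refl

  ≡ᵇ-injective : ∀ (f : ℕ → ℕ) a b → (f a ≡ f b → a ≡ b) → (f a ≡ᵇ f b) ≡ (a ≡ᵇ b)
  ≡ᵇ-injective f a b inj with a ≟ b
  ... | yes refl = trans (≡ᵇ-refl (f a)) (sym (≡ᵇ-refl a))
  ... | no a≢b = trans (≡ᵇ-false (f a) (f b) (λ e → a≢b (inj e))) (sym (≡ᵇ-false a b a≢b))

  ∧-true₃ : ∀ a b c → a ∧ (b ∧ c) ≡ true → a ≡ true × b ≡ true × c ≡ true
  ∧-true₃ true true true e = refl , refl , refl

  not-true : ∀ {c} → not c ≡ true → c ≡ false
  not-true {false} e = refl

  if-same : ∀ {A : Set} b (x : A) → (if b then x else x) ≡ x
  if-same true x = refl
  if-same false x = refl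

module Coding where

  open Pairing
  open BoolFacts
  open import Data.Nat
  open import Data.Nat.Properties using (≤-trans)
  open import Data.Bool using (Bool; true; false; _∧_)
  open import Data.Vec using (Vec; []; _∷_; toList) renaming (map to vmap)
  open import Data.Vec.Relation.Unary.All using (All; []; _∷_)
  import Data.Vec.Relation.Unary.All as All
  open import Data.List using (List; []; _∷_; length)
  open import Relation.Binary.PropositionalEquality

  codeL : List ℕ → ℕ
  codeL [] = 0
  codeL (x ∷ xs) = suc (cantor x (codeL xs))

  codeV : ∀ {n} (v : Vec ℕ n) → code v ≡ codeL (toList v)
  codeV [] = refl
  codeV (x ∷ v) = cong suc (trans (pair≡cantor x (code v)) (cong (cantor x) (codeV v)))

  -- bounds the number of steps a fold over a coded list needs
  length≤codeL : ∀ xs → length xs ≤ codeL xs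
  length≤codeL [] = z≤n
  length≤codeL (x ∷ xs) = s≤s (≤-trans (length≤codeL xs) (π₂≤cantor x (codeL xs)))

  component : ∀ {n} → Vec ℕ n → ℕ
  component [] = 0
  component (y ∷ _) = π₁ y

  headComponent : ℕ → ℕ
  headComponent c = π₁ (π₁ (pred c))

  headComponent-code : ∀ {n} (ys : Vec ℕ n) → headComponent (code ys) ≡ component ys
  headComponent-code [] = refl
  headComponent-code (y ∷ ys) = cong π₁ (trans (cong π₁ (pair≡cantor y (code ys))) (π₁-cantor y (code ys)))

  allIn : ℕ → List ℕ → Bool
  allIn p [] = true
  allIn p (x ∷ xs) = (π₁ x ≡ᵇ p) ∧ allIn p xs

  oneComponent : ∀ {n} → Vec ℕ n → Bool
  oneComponent ys = allIn (component ys) (toList ys)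

  allIn-sound : ∀ {n} p (ys : Vec ℕ n) → allIn p (toList ys) ≡ true → All (λ y → π₁ y ≡ p) ys
  allIn-sound p [] e = []
  allIn-sound p (y ∷ ys) e with π₁ y ≡ᵇ p in eq
  allIn-sound p (y ∷ ys) e | true = ≡ᵇ-true eq ∷ allIn-sound p ys e
  allIn-sound p (y ∷ ys) () | false

  allIn-complete : ∀ {n} p (ys : Vec ℕ n) → All (λ y → π₁ y ≡ p) ys → allIn p (toList ys) ≡ true
  allIn-complete p [] [] = refl
  allIn-complete p (y ∷ ys) (e ∷ es) rewrite e | ≡ᵇ-refl p = allIn-complete p ys es

  oneComponent-sound : ∀ {n} (ys : Vec ℕ n) → oneComponent ys ≡ true → All (λ y → π₁ y ≡ component ys) ys
  oneComponent-sound ys = allIn-sound (component ys) ys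

  oneComponent-const : ∀ {n} p (ys : Vec ℕ n) → All (λ y → π₁ y ≡ p) ys → oneComponent ys ≡ true
  oneComponent-const p [] [] = refl
  oneComponent-const p (y ∷ ys) (e ∷ es) =
    allIn-complete (π₁ y) (y ∷ ys) (refl ∷ All.map (λ e' → trans e' (sym e)) es)

  allIn-relabel : ∀ {n} (h σ : ℕ → ℕ) → (∀ a b → (σ a ≡ᵇ σ b) ≡ (a ≡ᵇ b)) →
                  (∀ z → π₁ (h z) ≡ σ (π₁ z)) → ∀ p (ys : Vec ℕ n) →
                  allIn (σ p) (toList (vmap h ys)) ≡ allIn p (toList ys)
  allIn-relabel h σ σ-inj hπ p [] = refl
  allIn-relabel h σ σ-inj hπ p (y ∷ ys) rewrite hπ y | σ-inj (π₁ y) p =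
    cong (_ ∧_) (allIn-relabel h σ σ-inj hπ p ys)

  oneComponent-relabel : ∀ {n} (h σ : ℕ → ℕ) → (∀ a b → (σ a ≡ᵇ σ b) ≡ (a ≡ᵇ b)) →
                         (∀ z → π₁ (h z) ≡ σ (π₁ z)) → (ys : Vec ℕ n) →
                         oneComponent (vmap h ys) ≡ oneComponent ys
  oneComponent-relabel h σ σ-inj hπ [] = refl
  oneComponent-relabel h σ σ-inj hπ (y ∷ ys) =
    trans (cong (λ p → allIn p (toList (vmap h (y ∷ ys)))) (hπ y)) (allIn-relabel h σ σ-inj hπ (π₁ y) (y ∷ ys))

-- (2) A library of programs relative to an oracle X.  Each program  c  comes
-- with a correctness lemma  ev-c : Ev c inputs (intended value).

module Programs (X : Oracle) where

  open Pairing
  open Coding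
  open import Data.Nat
  open import Data.Nat.Properties
  open import Data.Bool using (Bool; true; false; _∧_; not; if_then_else_)
  open import Data.Bool.Properties using (∧-identityʳ; ∧-assoc)
  open import Data.Fin using (Fin; zero; suc)
  import Data.Fin as Fin
  open import Data.Vec using (Vec; []; _∷_; lookup; toList) renaming (map to vmap)
  open import Data.Vec.Properties using (toList-map)
  open import Data.List using (List; []; _∷_; length; map; _ʳ++_; _++_)
  open import Data.List.Properties using (map-id; ʳ++-ʳ++; ++-identityʳ)
  open import Relation.Binary.PropositionalEquality
  open import Function using (_∘_; id)

  Ev : ∀ {n} → Code n → Vec ℕ n → ℕ → Set
  Ev = Eval X

  ev-≡ : ∀ {n} {e : Code n} {xs a b} → a ≡ b → Ev e xs a → Ev e xs b
  ev-≡ refl x = x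

  infixr 9 _∘₁_
  _∘₁_ : ∀ {n} → Code 1 → Code n → Code n
  f ∘₁ g = comp f (g ∷ [])

  ap1 : ∀ {n f g} {xs : Vec ℕ n} {y z} → Ev f (y ∷ []) z → Ev g xs y → Ev (f ∘₁ g) xs z
  ap1 ef eg = e-comp (eg ∷ []) ef

  c2 : ∀ {n} → Code 2 → Code n → Code n → Code n
  c2 f g h = comp f (g ∷ h ∷ [])

  ap2 : ∀ {n f g h} {xs : Vec ℕ n} {y₁ y₂ z} →
        Ev f (y₁ ∷ y₂ ∷ []) z → Ev g xs y₁ → Ev h xs y₂ → Ev (c2 f g h) xs z
  ap2 ef eg eh = e-comp (eg ∷ eh ∷ []) ef

  c3 : ∀ {n} → Code 3 → Code n → Code n → Code n → Code n
  c3 f g h k = comp f (g ∷ h ∷ k ∷ [])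

  ap3 : ∀ {n f g h k} {xs : Vec ℕ n} {y₁ y₂ y₃ z} →
        Ev f (y₁ ∷ y₂ ∷ y₃ ∷ []) z → Ev g xs y₁ → Ev h xs y₂ → Ev k xs y₃ → Ev (c3 f g h k) xs z
  ap3 ef eg eh ek = e-comp (eg ∷ eh ∷ ek ∷ []) ef

  p0 : ∀ {n} → Code (suc n)
  p0 = proj zero
  p1 : ∀ {n} → Code (suc (suc n))
  p1 = proj (suc zero)
  p2 : ∀ {n} → Code (suc (suc (suc n)))
  p2 = proj (suc (suc zero))

  cst : ∀ {n} → ℕ → Code n
  cst zero = zer
  cst (suc k) = sc ∘₁ cst k

  ev-cst : ∀ {n} k {xs : Vec ℕ n} → Ev (cst k) xs k
  ev-cst zero = e-zer
  ev-cst (suc k) = ap1 e-sc (ev-cst k)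

  add : Code 2
  add = prec p0 (sc ∘₁ p1)

  ev-add : ∀ a b → Ev add (a ∷ b ∷ []) (a + b)
  ev-add zero b = e-prec0 e-proj
  ev-add (suc a) b = e-precS (ev-add a b) (ap1 e-sc e-proj)

  mul : Code 2
  mul = prec zer (c2 add p2 p1)

  ev-mul : ∀ a b → Ev mul (a ∷ b ∷ []) (a * b)
  ev-mul zero b = e-prec0 e-zer
  ev-mul (suc a) b = e-precS (ev-mul a b) (ap2 (ev-add b (a * b)) e-proj e-proj)

  predC : Code 1
  predC = prec zer p0

  ev-pred : ∀ a → Ev predC (a ∷ []) (pred a)
  ev-pred zero = e-prec0 e-zer
  ev-pred (suc a) = e-precS (ev-pred a) e-proj

  -- truncated subtraction, by recursion on the subtrahend
  monusFlip : Code 2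
  monusFlip = prec p0 (predC ∘₁ p1)

  ev-monusFlip : ∀ b a → Ev monusFlip (b ∷ a ∷ []) (a ∸ b)
  ev-monusFlip zero a = e-prec0 e-proj
  ev-monusFlip (suc b) a =
    e-precS (ev-monusFlip b a) (ap1 (ev-≡ (pred[m∸n]≡m∸[1+n] a b) (ev-pred (a ∸ b))) e-proj)

  monus : Code 2
  monus = c2 monusFlip p1 p0

  ev-monus : ∀ a b → Ev monus (a ∷ b ∷ []) (a ∸ b)
  ev-monus a b = ap2 (ev-monusFlip b a) e-proj e-proj

  sg : ℕ → ℕ
  sg zero = 0
  sg (suc _) = 1

  nsg : ℕ → ℕ
  nsg zero = 1
  nsg (suc _) = 0

  sgC : Code 1
  sgC = prec zer (cst 1)

  ev-sg : ∀ a → Ev sgC (a ∷ []) (sg a)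
  ev-sg zero = e-prec0 e-zer
  ev-sg (suc a) = e-precS (ev-sg a) (ev-cst 1)

  nsgC : Code 1
  nsgC = prec (cst 1) zer

  ev-nsg : ∀ a → Ev nsgC (a ∷ []) (nsg a)
  ev-nsg zero = e-prec0 (ev-cst 1)
  ev-nsg (suc a) = e-precS (ev-nsg a) e-zer

  nsg-b2n : ∀ b → nsg (b2n b) ≡ b2n (not b)
  nsg-b2n true = refl
  nsg-b2n false = refl

  eqℕ : ℕ → ℕ → ℕ
  eqℕ a b = b2n (a ≡ᵇ b)

  eqC : Code 2
  eqC = nsgC ∘₁ c2 add monus (c2 monus p1 p0)

  eqℕ-via-monus : ∀ a b → nsg ((a ∸ b) + (b ∸ a)) ≡ eqℕ a b
  eqℕ-via-monus zero zero = refl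
  eqℕ-via-monus zero (suc b) = refl
  eqℕ-via-monus (suc a) zero = refl
  eqℕ-via-monus (suc a) (suc b) = eqℕ-via-monus a b

  ev-eq : ∀ a b → Ev eqC (a ∷ b ∷ []) (eqℕ a b)
  ev-eq a b = ev-≡ (eqℕ-via-monus a b)
    (ap1 (ev-nsg _) (ap2 (ev-add _ _) (ev-monus a b) (ap2 (ev-monus b a) e-proj e-proj)))

  triC : Code 1
  triC = prec zer (c2 add p1 (sc ∘₁ p0))

  ev-tri : ∀ k → Ev triC (k ∷ []) (tri k)
  ev-tri zero = e-prec0 e-zer
  ev-tri (suc k) = e-precS (ev-tri k) (ap2 (ev-add _ _) e-proj (ap1 e-sc e-proj))

  cantorC : Code 2
  cantorC = c2 add (triC ∘₁ c2 add p0 p1) p1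

  ev-cantor : ∀ a b → Ev cantorC (a ∷ b ∷ []) (cantor a b)
  ev-cantor a b = ap2 (ev-add _ _) (ap1 (ev-tri _) (ap2 (ev-add a b) e-proj e-proj)) e-proj

  -- the search condition:  suc z ∸ tri (suc t)  vanishes first at  t = diag z
  diagTest : Code 2
  diagTest = c2 monus (sc ∘₁ p1) (triC ∘₁ sc ∘₁ p0)

  ev-diagTest : ∀ t z → Ev diagTest (t ∷ z ∷ []) (suc z ∸ tri (suc t))
  ev-diagTest t z = ap2 (ev-monus _ _) (ap1 e-sc e-proj) (ap1 (ev-tri _) (ap1 e-sc e-proj))

  diagC : Code 1
  diagC = mu diagTest

  ev-diag : ∀ z → Ev diagC (z ∷ []) (diag z)
  ev-diag z = e-mu (ev-≡ (diag-stop z) (ev-diagTest (diag z) z))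
    (λ t t<r → z ∸ tri (suc t) , ev-≡ (diag-continue z t t<r) (ev-diagTest t z))

  π₂C : Code 1
  π₂C = c2 monus p0 (triC ∘₁ diagC)

  ev-π₂ : ∀ z → Ev π₂C (z ∷ []) (π₂ z)
  ev-π₂ z = ap2 (ev-monus _ _) e-proj (ap1 (ev-tri _) (ev-diag z))

  π₁C : Code 1
  π₁C = c2 monus diagC π₂C

  ev-π₁ : ∀ z → Ev π₁C (z ∷ []) (π₁ z)
  ev-π₁ z = ap2 (ev-monus _ _) (ev-diag z) (ev-π₂ z)

  -- guarded evaluation:  grd c b  is 0 when c is 0 and b otherwise; b is only
  -- run when the guard holds, so it need not halt elsewhere

  projections : ∀ {m n} → (Fin n → Fin m) → Vec (Code m) n
  projections {n = zero} ρ = []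
  projections {n = suc n} ρ = proj (ρ zero) ∷ projections (ρ ∘ suc)

  ev-projections : ∀ {m n} (ρ : Fin n → Fin m) (xs : Vec ℕ m) (ys : Vec ℕ n) →
                   (∀ i → lookup xs (ρ i) ≡ lookup ys i) → EvalAll X (projections ρ) xs ys
  ev-projections ρ xs [] h = []
  ev-projections ρ xs (y ∷ ys) h = ev-≡ (h zero) e-proj ∷ ev-projections (ρ ∘ suc) xs ys (h ∘ suc)

  skipTwo : ∀ {n} → Fin n → Fin (suc (suc n))
  skipTwo i = Fin.suc (Fin.suc i)

  -- primitive recursion on the sign of the guard; the step ignores the
  -- counter and the previous value (the first two arguments)
  grd : ∀ {n} → Code n → Code n → Code n
  grd c b = comp (prec zer (comp b (projections skipTwo))) ((sgC ∘₁ c) ∷ projections id)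

  ev-grd : ∀ {n c b} {xs : Vec ℕ n} (β : Bool) {y} → Ev c xs (b2n β) → (β ≡ true → Ev b xs y) →
           Ev (grd c b) xs (if β then y else 0)
  ev-grd {xs = xs} true ec eb = e-comp (ap1 (ev-sg 1) ec ∷ ev-projections id xs xs (λ _ → refl))
    (e-precS (e-prec0 e-zer) (e-comp (ev-projections skipTwo _ xs (λ _ → refl)) (eb refl)))
  ev-grd {xs = xs} false ec eb = e-comp (ap1 (ev-sg 0) ec ∷ ev-projections id xs xs (λ _ → refl)) (e-prec0 e-zer)

  -- The state ⟨remaining list, accumulator⟩ is
  -- updated by one step per iteration; as the length of a list is at most
  -- its code, iterating  code  many times reaches the empty list, which is a
  -- fixed point of the step.
  module Fold (G : Code 3) (g : ℕ → ℕ → ℕ → ℕ)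
              (ev-G : ∀ p x a → Ev G (p ∷ x ∷ a ∷ []) (g p x a)) (a₀ : ℕ) where

    foldlℕ : ℕ → List ℕ → ℕ → ℕ
    foldlℕ p [] a = a
    foldlℕ p (x ∷ xs) a = foldlℕ p xs (g p x a)

    step : ℕ → ℕ → ℕ
    step p st = sg (π₁ st) * cantor (π₂ (pred (π₁ st))) (g p (π₁ (pred (π₁ st))) (π₂ st))
                + nsg (π₁ st) * st

    stepC : Code 2
    stepC = c2 add (c2 mul (sgC ∘₁ rest) new) (c2 mul (nsgC ∘₁ rest) p1)
      where
      rest = π₁C ∘₁ p1
      acc = π₂C ∘₁ p1
      hd = π₁C ∘₁ predC ∘₁ rest
      tl = π₂C ∘₁ predC ∘₁ rest
      new = c2 cantorC tl (c3 G p0 hd acc)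

    ev-step : ∀ p st → Ev stepC (p ∷ st ∷ []) (step p st)
    ev-step p st = ap2 (ev-add _ _)
      (ap2 (ev-mul _ _) (ap1 (ev-sg _) rest)
         (ap2 (ev-cantor _ _) (ap1 (ev-π₂ _) (ap1 (ev-pred _) rest))
            (ap3 (ev-G _ _ _) e-proj (ap1 (ev-π₁ _) (ap1 (ev-pred _) rest)) (ap1 (ev-π₂ _) e-proj))))
      (ap2 (ev-mul _ _) (ap1 (ev-nsg _) rest) e-proj)
      where
      rest : Ev (π₁C ∘₁ p1) (p ∷ st ∷ []) (π₁ st)
      rest = ap1 (ev-π₁ st) e-proj

    iterate : ℕ → ℕ → ℕ → ℕ
    iterate zero p st = st
    iterate (suc k) p st = step p (iterate k p st)

    iterateC : Code 3
    iterateC = prec (c2 cantorC p1 (cst a₀)) (c2 stepC p2 p1)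

    ev-iterate : ∀ k p c → Ev iterateC (k ∷ p ∷ c ∷ []) (iterate k p (cantor c a₀))
    ev-iterate zero p c = e-prec0 (ap2 (ev-cantor _ _) e-proj (ev-cst a₀))
    ev-iterate (suc k) p c = e-precS (ev-iterate k p c) (ap2 (ev-step _ _) e-proj e-proj)

    foldC : Code 2
    foldC = π₂C ∘₁ c3 iterateC p1 p0 p1

    foldℕ : ℕ → ℕ → ℕ
    foldℕ p c = π₂ (iterate c p (cantor c a₀))

    ev-fold : ∀ p c → Ev foldC (p ∷ c ∷ []) (foldℕ p c)
    ev-fold p c = ap1 (ev-π₂ _) (ap3 (ev-iterate c p c) e-proj e-proj e-proj)

    step-done : ∀ p a → step p (cantor 0 a) ≡ cantor 0 a
    step-done p a rewrite π₁-cantor 0 a = +-identityʳ (cantor 0 a)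

    step-cons : ∀ p x c a → step p (cantor (suc (cantor x c)) a) ≡ cantor c (g p x a)
    step-cons p x c a rewrite π₁-cantor (suc (cantor x c)) a | π₂-cantor (suc (cantor x c)) a
      | π₁-cantor x c | π₂-cantor x c = trans (+-identityʳ _) (+-identityʳ _)

    iterate-done : ∀ k p a → iterate k p (cantor 0 a) ≡ cantor 0 a
    iterate-done zero p a = refl
    iterate-done (suc k) p a = trans (cong (step p) (iterate-done k p a)) (step-done p a)

    iterate-suc : ∀ k p st → iterate (suc k) p st ≡ iterate k p (step p st)
    iterate-suc zero p st = refl
    iterate-suc (suc k) p st = cong (step p) (iterate-suc k p st)

    iterate-list : ∀ p xs a j → iterate (length xs + j) p (cantor (codeL xs) a) ≡ cantor 0 (foldlℕ p xs a)
    iterate-list p [] a j = iterate-done j p a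
    iterate-list p (x ∷ xs) a j = trans (iterate-suc (length xs + j) p _)
      (trans (cong (iterate (length xs + j) p) (step-cons p x (codeL xs) a)) (iterate-list p xs (g p x a) j))

    fold-correct : ∀ p xs → foldℕ p (codeL xs) ≡ foldlℕ p xs a₀
    fold-correct p xs with m≤n⇒∃[o]m+o≡n (length≤codeL xs)
    ... | j , e = trans (cong (λ k → π₂ (iterate k p (cantor (codeL xs) a₀))) (sym e))
                   (trans (cong π₂ (iterate-list p xs a₀ j)) (π₂-cantor 0 _))

  -- Mapping a computable function over a coded list.  A left fold that conses
  -- onto its accumulator maps and reverses; doing it twice restores the order.
  module ReverseMap (h : Code 1) (hℕ : ℕ → ℕ) (ev-h : ∀ x → Ev h (x ∷ []) (hℕ x)) where
    G : Code 3
    G = sc ∘₁ c2 cantorC (h ∘₁ p1) p2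

    consAfter : ℕ → ℕ → ℕ → ℕ
    consAfter p x a = suc (cantor (hℕ x) a)

    ev-G : ∀ p x a → Ev G (p ∷ x ∷ a ∷ []) (consAfter p x a)
    ev-G p x a = ap1 e-sc (ap2 (ev-cantor _ _) (ap1 (ev-h x) e-proj) e-proj)

    open Fold G consAfter ev-G 0 public

    fold-reverse : ∀ p xs zs → foldlℕ p xs (codeL zs) ≡ codeL (map hℕ xs ʳ++ zs)
    fold-reverse p [] zs = refl
    fold-reverse p (x ∷ xs) zs = fold-reverse p xs (hℕ x ∷ zs)

  module Reverse = ReverseMap p0 id (λ x → e-proj)

  module Map (h : Code 1) (hℕ : ℕ → ℕ) (ev-h : ∀ x → Ev h (x ∷ []) (hℕ x)) where
    module M = ReverseMap h hℕ ev-h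

    mapC : Code 1
    mapC = c2 Reverse.foldC (cst 0) (c2 M.foldC (cst 0) p0)

    mapℕ : ℕ → ℕ
    mapℕ c = Reverse.foldℕ 0 (M.foldℕ 0 c)

    ev-map : ∀ c → Ev mapC (c ∷ []) (mapℕ c)
    ev-map c = ap2 (Reverse.ev-fold _ _) (ev-cst 0) (ap2 (M.ev-fold _ _) (ev-cst 0) e-proj)

    map-correct : ∀ xs → mapℕ (codeL xs) ≡ codeL (map hℕ xs)
    map-correct xs = begin
      Reverse.foldℕ 0 (M.foldℕ 0 (codeL xs))   ≡⟨ cong (Reverse.foldℕ 0) (trans (M.fold-correct 0 xs) (M.fold-reverse 0 xs [])) ⟩
      Reverse.foldℕ 0 (codeL rev)              ≡⟨ Reverse.fold-correct 0 rev ⟩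
      Reverse.foldlℕ 0 rev 0                   ≡⟨ Reverse.fold-reverse 0 rev [] ⟩
      codeL (map id rev ʳ++ [])                ≡⟨ cong (λ l → codeL (l ʳ++ [])) (map-id rev) ⟩
      codeL (rev ʳ++ [])                       ≡⟨ cong codeL (trans (ʳ++-ʳ++ (map hℕ xs)) (++-identityʳ _)) ⟩
      codeL (map hℕ xs)                        ∎
      where
      open ≡-Reasoning
      rev = map hℕ xs ʳ++ []

    ev-mapV : ∀ {n} (ys : Vec ℕ n) → Ev mapC (code ys ∷ []) (code (vmap hℕ ys))
    ev-mapV ys = ev-≡ (begin
        mapℕ (code ys)                     ≡⟨ cong mapℕ (codeV ys) ⟩
        mapℕ (codeL (toList ys))           ≡⟨ map-correct (toList ys) ⟩
        codeL (map hℕ (toList ys))         ≡⟨ cong codeL (sym (toList-map hℕ ys)) ⟩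
        codeL (toList (vmap hℕ ys))        ≡⟨ sym (codeV (vmap hℕ ys)) ⟩
        code (vmap hℕ ys)                  ∎)
      (ev-map (code ys))
      where open ≡-Reasoning

  -- Testing whether all entries of a coded tuple lie in one component, by
  -- folding a running product of equality tests.
  b2n-∧ : ∀ b c → b2n b * b2n c ≡ b2n (b ∧ c)
  b2n-∧ true true = refl
  b2n-∧ true false = refl
  b2n-∧ false c = refl

  module AllIn where
    G : Code 3
    G = c2 mul p2 (c2 eqC (π₁C ∘₁ p1) p0)

    update : ℕ → ℕ → ℕ → ℕ
    update p x a = a * eqℕ (π₁ x) p

    ev-G : ∀ p x a → Ev G (p ∷ x ∷ a ∷ []) (update p x a)
    ev-G p x a = ap2 (ev-mul _ _) e-proj (ap2 (ev-eq _ _) (ap1 (ev-π₁ _) e-proj) e-proj)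

    open Fold G update ev-G 1 public

    fold-allIn : ∀ p xs b → foldlℕ p xs (b2n b) ≡ b2n (b ∧ allIn p xs)
    fold-allIn p [] b = cong b2n (sym (∧-identityʳ b))
    fold-allIn p (x ∷ xs) b = trans (cong (foldlℕ p xs) (b2n-∧ b _))
      (trans (fold-allIn p xs _) (cong b2n (∧-assoc b _ _)))

  componentC : Code 1
  componentC = π₁C ∘₁ π₁C ∘₁ predC

  ev-component : ∀ {n} (ys : Vec ℕ n) → Ev componentC (code ys ∷ []) (component ys)
  ev-component ys = ev-≡ (headComponent-code ys) (ap1 (ev-π₁ _) (ap1 (ev-π₁ _) (ev-pred (code ys))))

  oneComponentC : Code 1
  oneComponentC = c2 AllIn.foldC componentC p0

  ev-oneComponent : ∀ {n} (ys : Vec ℕ n) → Ev oneComponentC (code ys ∷ []) (b2n (oneComponent ys))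
  ev-oneComponent ys = ev-≡ (begin
      AllIn.foldℕ (component ys) (code ys)               ≡⟨ cong (AllIn.foldℕ _) (codeV ys) ⟩
      AllIn.foldℕ (component ys) (codeL (toList ys))     ≡⟨ AllIn.fold-correct _ (toList ys) ⟩
      AllIn.foldlℕ (component ys) (toList ys) 1          ≡⟨ AllIn.fold-allIn _ (toList ys) true ⟩
      b2n (oneComponent ys)                              ∎)
    (ap2 (AllIn.ev-fold _ _) (ev-component ys) e-proj)
    where open ≡-Reasoning
-- (3) The relational language L' and the disjoint union P ⊔ Q.
--
-- The symbol ⟨t, r⟩ of L' is
--   t = 0 : the relation r of L;
--   t = 1 : the graph  y = f(xs)  of the function f = r of L;
--   t = 2 : the binary relation "same component";
--   t ≥ 3 : a nullary relation that never holds.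
-- Elements of P ⊔ Q are codes ⟨k, a⟩ with a in P if k = 0 and in Q otherwise.

module Symbols (L : Language) where

  open Language L
  open Pairing
  open Programs ∅
  open import Data.Nat
  open import Data.Nat.Properties using (+-identityʳ)
  open import Data.Bool using (true; false)
  open import Data.Vec using (_∷_; [])
  open import Data.Product using (proj₂)
  open import Relation.Binary.PropositionalEquality

  arity : ℕ → ℕ → ℕ
  arity zero r = rar r
  arity (suc zero) f = suc (far f)
  arity (suc (suc zero)) _ = 2
  arity (suc (suc (suc _))) _ = 0

  arity' : ℕ → ℕ
  arity' s = arity (π₁ s) (π₂ s)

  -- arity' is computed by a case distinction on the kind of the symbol
  arity-cases : ∀ t r → eqℕ t 0 * rar r + (eqℕ t 1 * suc (far r) + eqℕ t 2 * 2) ≡ arity t r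
  arity-cases zero r = trans (+-identityʳ _) (+-identityʳ _)
  arity-cases (suc zero) r = trans (+-identityʳ _) (+-identityʳ _)
  arity-cases (suc (suc zero)) r = refl
  arity-cases (suc (suc (suc t))) r = refl

  arityC : Code 1
  arityC = c2 add (c2 mul (c2 eqC kind (cst 0)) (proj₁ rar-comp ∘₁ symbol))
          (c2 add (c2 mul (c2 eqC kind (cst 1)) (sc ∘₁ proj₁ far-comp ∘₁ symbol))
                  (c2 mul (c2 eqC kind (cst 2)) (cst 2)))
    where
    kind = π₁C ∘₁ p0
    symbol = π₂C ∘₁ p0

  ev-arity : ∀ s → Eval ∅ arityC (s ∷ []) (arity' s)
  ev-arity s = ev-≡ (arity-cases (π₁ s) (π₂ s))
    (ap2 (ev-add _ _) (ap2 (ev-mul _ _) (ap2 (ev-eq _ _) kindE (ev-cst 0)) (ap1 (proj₂ rar-comp _) symE))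
      (ap2 (ev-add _ _) (ap2 (ev-mul _ _) (ap2 (ev-eq _ _) kindE (ev-cst 1)) (ap1 e-sc (ap1 (proj₂ far-comp _) symE)))
         (ap2 (ev-mul _ _) (ap2 (ev-eq _ _) kindE (ev-cst 2)) (ev-cst 2))))
    where
    kindE = ap1 (ev-π₁ s) e-proj
    symE = ap1 (ev-π₂ s) e-proj

  L' : Language
  L' = record
    { isRel = λ _ → true
    ; isFun = λ _ → false
    ; rar = arity'
    ; far = λ _ → 0
    ; isRel-comp = cst 1 , λ _ → ev-cst 1
    ; isFun-comp = zer , λ _ → e-zer
    ; rar-comp = arityC , ev-arity
    ; far-comp = zer , λ _ → e-zer
    }

module Union (L : Language) (P Q : Structure L) where

  open Language L
  open Symbols L
  open Pairing
  open Coding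
  open BoolFacts using (not-true)
  open import Data.Nat
  open import Data.Bool using (Bool; true; false; _∧_; not; if_then_else_)
  open import Data.Vec using (Vec; []; _∷_) renaming (map to vmap)
  open import Data.Vec.Relation.Unary.All using (All; []; _∷_)
  open import Data.Product using (proj₂)
  open import Relation.Binary.PropositionalEquality
  private
    module P = Structure P
    module Q = Structure Q

  inP : ℕ → Bool
  inP k = k ≡ᵇ 0

  udom : ℕ → Bool
  udom z = if inP (π₁ z) then P.dom (π₂ z) else Q.dom (π₂ z)

  -- the atomic diagram of P ⊔ Q: relations and function graphs hold only
  -- among elements of one component, where they are read off P or Q
  holds : ∀ t r → Vec ℕ (arity t r) → Bool
  holds zero r ys = isRel r ∧ (oneComponent ys ∧
    (if inP (component ys) then P.Rel r (vmap π₂ ys) else Q.Rel r (vmap π₂ ys)))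
  holds (suc zero) f (y ∷ xs) = isFun f ∧ (oneComponent (y ∷ xs) ∧
    (π₂ y ≡ᵇ (if inP (π₁ y) then P.Fun f (vmap π₂ xs) else Q.Fun f (vmap π₂ xs))))
  holds (suc (suc zero)) _ (x ∷ y ∷ []) = π₁ x ≡ᵇ π₁ y
  holds (suc (suc (suc _))) _ [] = false

  dom-inP : ∀ y → inP (π₁ y) ≡ true → udom y ≡ true → P.dom (π₂ y) ≡ true
  dom-inP y e d with inP (π₁ y)
  dom-inP y refl d | .true = d

  dom-inQ : ∀ y → inP (π₁ y) ≡ false → udom y ≡ true → Q.dom (π₂ y) ≡ true
  dom-inQ y e d with inP (π₁ y)
  dom-inQ y refl d | .false = d

  dom-component : ∀ {n} (b : Bool) (D : ℕ → Bool) p (ys : Vec ℕ n) →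
                  (∀ y → inP (π₁ y) ≡ b → udom y ≡ true → D (π₂ y) ≡ true) →
                  All (λ y → π₁ y ≡ p) ys → inP p ≡ b → All (λ a → udom a ≡ true) ys →
                  All (λ a → D a ≡ true) (vmap π₂ ys)
  dom-component b D p [] h [] e [] = []
  dom-component b D p (y ∷ ys) h (q ∷ qs) e (d ∷ ds) =
    h y (trans (cong inP q) e) d ∷ dom-component b D p ys h qs e ds

  inside-P : ∀ {n} (ys : Vec ℕ n) → oneComponent ys ≡ true → inP (component ys) ≡ true →
             All (λ a → udom a ≡ true) ys → All (λ a → P.dom a ≡ true) (vmap π₂ ys)
  inside-P ys one inp = dom-component true P.dom (component ys) ys dom-inP (oneComponent-sound ys one) inp

  inside-Q : ∀ {n} (ys : Vec ℕ n) → oneComponent ys ≡ true → not (inP (component ys)) ≡ true →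
             All (λ a → udom a ≡ true) ys → All (λ a → Q.dom a ≡ true) (vmap π₂ ys)
  inside-Q ys one inq = dom-component false Q.dom (component ys) ys dom-inQ (oneComponent-sound ys one) (not-true inq)

  udom-inP : ∀ a → udom (cantor 0 a) ≡ P.dom a
  udom-inP a rewrite π₁-cantor 0 a | π₂-cantor 0 a = refl

  U : Structure L'
  U = record
    { dom = udom
    ; nonempty = cantor 0 (proj₁ P.nonempty) , trans (udom-inP _) (proj₂ P.nonempty)
    ; Rel = λ s ys → holds (π₁ s) (π₂ s) ys
    ; Fun = λ _ _ → 0
    ; Fun-closed = λ _ ()
    }

-- (4) The disjoint union of computable structures is computable.  The
-- domain is decided by a case distinction on the component; the diagram by
-- a case distinction on the kind of the symbol, where every query to the
-- diagrams of P and Q is guarded so that it is only made on tuples of the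
-- right domain.

module UnionComputable (L : Language) (P Q : Structure L) (cP : IsComputable P) (cQ : IsComputable Q) where

  open Language L
  open Symbols L
  open Union L P Q
  open Pairing
  open BoolFacts
  open Coding
  open Programs ∅
  open import Data.Nat
  open import Data.Nat.Properties using (+-identityʳ)
  open import Data.Bool using (Bool; true; false; _∧_; not; if_then_else_)
  open import Data.Vec using (Vec; []; _∷_) renaming (map to vmap)
  open import Data.Vec.Relation.Unary.All using (All; []; _∷_)
  import Data.Vec.Relation.Unary.All as All
  open import Data.Product using (proj₂)
  open import Relation.Binary.PropositionalEquality
  private
    module P = Structure P
    module Q = Structure Q
    module cP = IsComputable cP
    module cQ = IsComputable cQ

  -- Boolean selections as arithmetic on characteristic values
  select : ∀ b u v → b2n b * b2n u + nsg (b2n b) * b2n v ≡ b2n (if b then u else v)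
  select true true v = refl
  select true false v = refl
  select false u true = refl
  select false u false = refl

  select-guarded : ∀ a b c u v → b2n (a ∧ (b ∧ (if c then u else v))) ≡
                   (if a ∧ (b ∧ c) then b2n u else 0) + (if a ∧ (b ∧ not c) then b2n v else 0)
  select-guarded true true true true v = refl
  select-guarded true true true false v = refl
  select-guarded true true false u true = refl
  select-guarded true true false u false = refl
  select-guarded true false c u v = refl
  select-guarded false b c u v = refl

  select-graph : ∀ a b c (m u v : ℕ) → b2n (a ∧ (b ∧ (m ≡ᵇ (if c then u else v)))) ≡
                 b2n (a ∧ (b ∧ c)) * eqℕ m (if a ∧ (b ∧ c) then u else 0) +
                 b2n (a ∧ (b ∧ not c)) * eqℕ m (if a ∧ (b ∧ not c) then v else 0)
  select-graph true true true m u v = sym (trans (+-identityʳ _) (+-identityʳ _))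
  select-graph true true false m u v = sym (+-identityʳ _)
  select-graph true false c m u v = refl
  select-graph false b c m u v = refl

  b2n-∧₃ : ∀ a b c → b2n a * (b2n b * b2n c) ≡ b2n (a ∧ (b ∧ c))
  b2n-∧₃ a b c = trans (cong (b2n a *_) (b2n-∧ b c)) (b2n-∧ a (b ∧ c))

  domC : Code 1
  domC = c2 add (c2 mul inPC (proj₁ cP.dom-comp ∘₁ π₂C ∘₁ p0))
                (c2 mul (nsgC ∘₁ inPC) (proj₁ cQ.dom-comp ∘₁ π₂C ∘₁ p0))
    where inPC = c2 eqC (π₁C ∘₁ p0) (cst 0)

  ev-dom : ∀ z → Eval ∅ domC (z ∷ []) (b2n (udom z))
  ev-dom z = ev-≡ (select (inP (π₁ z)) (P.dom (π₂ z)) (Q.dom (π₂ z)))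
    (ap2 (ev-add _ _) (ap2 (ev-mul _ _) inPE (ap1 (proj₂ cP.dom-comp _) secondE))
                      (ap2 (ev-mul _ _) (ap1 (ev-nsg _) inPE) (ap1 (proj₂ cQ.dom-comp _) secondE)))
    where
    secondE = ap1 (ev-π₂ z) e-proj
    inPE = ap2 (ev-eq _ _) (ap1 (ev-π₁ z) e-proj) (ev-cst 0)

  module Seconds = Map π₂C π₂ ev-π₂

  kindC symC oneCompC inPC notInPC secondsC headC tailC tailSecondsC secondC : Code 2
  kindC = π₁C ∘₁ p0
  symC = π₂C ∘₁ p0
  oneCompC = oneComponentC ∘₁ p1
  inPC = c2 eqC (componentC ∘₁ p1) (cst 0)
  notInPC = nsgC ∘₁ inPC
  secondsC = Seconds.mapC ∘₁ p1
  headC = π₁C ∘₁ predC ∘₁ p1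
  tailC = π₂C ∘₁ predC ∘₁ p1
  tailSecondsC = Seconds.mapC ∘₁ tailC
  secondC = π₁C ∘₁ predC ∘₁ tailC

  guard : Code 1 → Code 2 → Code 2
  guard isSym inC = c2 mul (isSym ∘₁ symC) (c2 mul oneCompC inC)

  relCaseC graphCaseC sameCaseC holdsC : Code 2
  relCaseC = c2 add (grd (guard (proj₁ isRel-comp) inPC) (c2 (proj₁ cP.rel-comp) symC secondsC))
                    (grd (guard (proj₁ isRel-comp) notInPC) (c2 (proj₁ cQ.rel-comp) symC secondsC))
  graphCaseC = c2 add (graphIn (guard (proj₁ isFun-comp) inPC) (proj₁ cP.fun-comp))
                      (graphIn (guard (proj₁ isFun-comp) notInPC) (proj₁ cQ.fun-comp))
    where
    graphIn : Code 2 → Code 2 → Code 2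
    graphIn g funC = c2 mul g (c2 eqC (π₂C ∘₁ headC) (grd g (c2 funC symC tailSecondsC)))
  sameCaseC = c2 eqC (π₁C ∘₁ headC) (π₁C ∘₁ secondC)
  holdsC = c2 add (grd (isKind 0) relCaseC) (c2 add (grd (isKind 1) graphCaseC) (grd (isKind 2) sameCaseC))
    where
    isKind : ℕ → Code 2
    isKind k = c2 eqC kindC (cst k)

  module Inputs (s : ℕ) {n} (ys : Vec ℕ n) where
    I : Vec ℕ 2
    I = s ∷ code ys ∷ []
    kindE : Eval ∅ kindC I (π₁ s)
    kindE = ap1 (ev-π₁ s) e-proj
    symE : Eval ∅ symC I (π₂ s)
    symE = ap1 (ev-π₂ s) e-proj
    inPE : Eval ∅ inPC I (b2n (inP (component ys)))
    inPE = ap2 (ev-eq _ _) (ap1 (ev-component ys) e-proj) (ev-cst 0)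
    notInPE : Eval ∅ notInPC I (b2n (not (inP (component ys))))
    notInPE = ev-≡ (nsg-b2n _) (ap1 (ev-nsg _) inPE)
    secondsE : Eval ∅ secondsC I (code (vmap π₂ ys))
    secondsE = ap1 (Seconds.ev-mapV ys) e-proj

    oneCompE : Eval ∅ oneCompC I (b2n (oneComponent ys))
    oneCompE = ap1 (ev-oneComponent ys) e-proj

    guardE : ∀ {isSym inC} r → π₂ s ≡ r → (a c : Bool) → (Eval ∅ isSym (r ∷ []) (b2n a)) →
             Eval ∅ inC I (b2n c) → Eval ∅ (guard isSym inC) I (b2n (a ∧ (oneComponent ys ∧ c)))
    guardE r er a c isSymE inE = ev-≡ (b2n-∧₃ a (oneComponent ys) c)
      (ap2 (ev-mul _ _) (ap1 isSymE (ev-≡ er symE)) (ap2 (ev-mul _ _) oneCompE inE))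

  module HeadInputs (s : ℕ) {n} (y : ℕ) (xs : Vec ℕ n) where
    I : Vec ℕ 2
    I = s ∷ code (y ∷ xs) ∷ []
    headE : Eval ∅ headC I y
    headE = ev-≡ (trans (cong π₁ (pair≡cantor y (code xs))) (π₁-cantor y (code xs)))
                 (ap1 (ev-π₁ _) (ap1 (ev-pred _) e-proj))
    tailE : Eval ∅ tailC I (code xs)
    tailE = ev-≡ (trans (cong π₂ (pair≡cantor y (code xs))) (π₂-cantor y (code xs)))
                 (ap1 (ev-π₂ _) (ap1 (ev-pred _) e-proj))
    tailSecondsE : Eval ∅ tailSecondsC I (code (vmap π₂ xs))
    tailSecondsE = ap1 (Seconds.ev-mapV xs) tailE

  relCaseE : ∀ s r → π₂ s ≡ r → (ys : Vec ℕ (rar r)) → All (λ a → udom a ≡ true) ys →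
             Eval ∅ relCaseC (s ∷ code ys ∷ []) (b2n (holds 0 r ys))
  relCaseE s r er ys ds =
    ev-≡ (sym (select-guarded (isRel r) (oneComponent ys) (inP (component ys)) (P.Rel r (vmap π₂ ys)) (Q.Rel r (vmap π₂ ys))))
      (ap2 (ev-add _ _) (ev-grd _ (guardE r er (isRel r) _ (proj₂ isRel-comp r) inPE) queryP)
                        (ev-grd _ (guardE r er (isRel r) _ (proj₂ isRel-comp r) notInPE) queryQ))
    where
    open Inputs s ys
    queryP : isRel r ∧ (oneComponent ys ∧ inP (component ys)) ≡ true →
             Eval ∅ (c2 (proj₁ cP.rel-comp) symC secondsC) I (b2n (P.Rel r (vmap π₂ ys)))
    queryP β with ∧-true₃ _ _ _ β
    ... | isR , one , inp = ap2 (proj₂ cP.rel-comp r isR (vmap π₂ ys) (inside-P ys one inp ds)) (ev-≡ er symE) secondsE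
    queryQ : isRel r ∧ (oneComponent ys ∧ not (inP (component ys))) ≡ true →
             Eval ∅ (c2 (proj₁ cQ.rel-comp) symC secondsC) I (b2n (Q.Rel r (vmap π₂ ys)))
    queryQ β with ∧-true₃ _ _ _ β
    ... | isR , one , inq = ap2 (proj₂ cQ.rel-comp r isR (vmap π₂ ys) (inside-Q ys one inq ds)) (ev-≡ er symE) secondsE

  graphCaseE : ∀ s f → π₂ s ≡ f → ∀ y (xs : Vec ℕ (far f)) → All (λ a → udom a ≡ true) (y ∷ xs) →
               Eval ∅ graphCaseC (s ∷ code (y ∷ xs) ∷ []) (b2n (holds 1 f (y ∷ xs)))
  graphCaseE s f er y xs ds =
    ev-≡ (sym (select-graph (isFun f) (oneComponent (y ∷ xs)) (inP (π₁ y)) (π₂ y) (P.Fun f (vmap π₂ xs)) (Q.Fun f (vmap π₂ xs))))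
      (ap2 (ev-add _ _)
        (ap2 (ev-mul _ _) guardP (ap2 (ev-eq _ _) (ap1 (ev-π₂ _) headE) (ev-grd _ guardP queryP)))
        (ap2 (ev-mul _ _) guardQ (ap2 (ev-eq _ _) (ap1 (ev-π₂ _) headE) (ev-grd _ guardQ queryQ))))
    where
    open Inputs s (y ∷ xs)
    open HeadInputs s y xs using (headE; tailSecondsE)
    guardP = guardE f er (isFun f) _ (proj₂ isFun-comp f) inPE
    guardQ = guardE f er (isFun f) _ (proj₂ isFun-comp f) notInPE
    queryP : isFun f ∧ (oneComponent (y ∷ xs) ∧ inP (π₁ y)) ≡ true →
             Eval ∅ (c2 (proj₁ cP.fun-comp) symC tailSecondsC) I (P.Fun f (vmap π₂ xs))
    queryP β with ∧-true₃ _ _ _ β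
    ... | isF , one , inp = ap2 (proj₂ cP.fun-comp f isF (vmap π₂ xs) (All.tail (inside-P (y ∷ xs) one inp ds)))
                                (ev-≡ er symE) tailSecondsE
    queryQ : isFun f ∧ (oneComponent (y ∷ xs) ∧ not (inP (π₁ y))) ≡ true →
             Eval ∅ (c2 (proj₁ cQ.fun-comp) symC tailSecondsC) I (Q.Fun f (vmap π₂ xs))
    queryQ β with ∧-true₃ _ _ _ β
    ... | isF , one , inq = ap2 (proj₂ cQ.fun-comp f isF (vmap π₂ xs) (All.tail (inside-Q (y ∷ xs) one inq ds)))
                                (ev-≡ er symE) tailSecondsE

  sameCaseE : ∀ s x y → Eval ∅ sameCaseC (s ∷ code (x ∷ y ∷ []) ∷ []) (b2n (π₁ x ≡ᵇ π₁ y))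
  sameCaseE s x y = ap2 (ev-eq _ _) (ap1 (ev-π₁ _) headE) (ap1 (ev-π₁ _) secondE)
    where
    open HeadInputs s x (y ∷ []) using (headE; tailE)
    secondE : Eval ∅ secondC (s ∷ code (x ∷ y ∷ []) ∷ []) y
    secondE = ev-≡ (trans (cong π₁ (pair≡cantor y 0)) (π₁-cantor y 0)) (ap1 (ev-π₁ _) (ap1 (ev-pred _) tailE))

  kindIs : ∀ s {t n} (ys : Vec ℕ n) → π₁ s ≡ t → ∀ k →
           Eval ∅ (c2 eqC kindC (cst k)) (s ∷ code ys ∷ []) (b2n (t ≡ᵇ k))
  kindIs s ys et k = ap2 (ev-eq _ _) (ev-≡ et (Inputs.kindE s ys)) (ev-cst k)

  holdsE : ∀ s t r → π₁ s ≡ t → π₂ s ≡ r → (ys : Vec ℕ (arity t r)) →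
           All (λ a → udom a ≡ true) ys → Eval ∅ holdsC (s ∷ code ys ∷ []) (b2n (holds t r ys))
  holdsE s zero r et er ys ds = ev-≡ (+-identityʳ _)
    (ap2 (ev-add _ _) (ev-grd true (kindIs s ys et 0) (λ _ → relCaseE s r er ys ds))
      (ap2 (ev-add _ _) (ev-grd false {y = 0} (kindIs s ys et 1) (λ ())) (ev-grd false {y = 0} (kindIs s ys et 2) (λ ()))))
  holdsE s (suc zero) f et er (y ∷ xs) ds = ev-≡ (+-identityʳ _)
    (ap2 (ev-add _ _) (ev-grd false {y = 0} (kindIs s (y ∷ xs) et 0) (λ ()))
      (ap2 (ev-add _ _) (ev-grd true (kindIs s (y ∷ xs) et 1) (λ _ → graphCaseE s f er y xs ds))
                        (ev-grd false {y = 0} (kindIs s (y ∷ xs) et 2) (λ ()))))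
  holdsE s (suc (suc zero)) _ et er (x ∷ y ∷ []) ds =
    ap2 (ev-add _ _) (ev-grd false {y = 0} (kindIs s (x ∷ y ∷ []) et 0) (λ ()))
      (ap2 (ev-add _ _) (ev-grd false {y = 0} (kindIs s (x ∷ y ∷ []) et 1) (λ ()))
                        (ev-grd true (kindIs s (x ∷ y ∷ []) et 2) (λ _ → sameCaseE s x y)))
  holdsE s (suc (suc (suc t))) _ et er [] ds =
    ap2 (ev-add _ _) (ev-grd false {y = 0} (kindIs s [] et 0) (λ ()))
      (ap2 (ev-add _ _) (ev-grd false {y = 0} (kindIs s [] et 1) (λ ()))
                        (ev-grd false {y = 0} (kindIs s [] et 2) (λ ())))

  U-computable : IsComputable U
  U-computable = record
    { dom-comp = domC , ev-dom
    ; rel-comp = holdsC , λ s _ ys ds → holdsE s (π₁ s) (π₂ s) refl refl ys ds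
    ; fun-comp = zer , λ _ ()
    }

-- (5) Embeddings between the unions.  Throughout, A ⊔ B and B ⊔ B are the
-- unions  Union.U L A B  and  Union.U L B B.

module UnionEmbeddings (L : Language) (A B : Structure L) where

  open Language L
  open Symbols L
  open Pairing
  open BoolFacts
  open Coding
  open import Data.Nat
  open import Data.Nat.Properties using (suc-injective)
  open import Data.Bool using (true; false; _∧_; if_then_else_)
  open import Data.Vec using (Vec; []; _∷_) renaming (map to vmap)
  open import Data.Vec.Properties using (map-∘)
  open import Data.Vec.Relation.Unary.All using (All; []; _∷_)
  import Data.Vec.Relation.Unary.All as All
  open import Data.Product using (proj₂)
  open import Relation.Binary.PropositionalEquality
  module UA = Union L A B
  module UB = Union L B B
  private
    module A = Structure A
    module B = Structure B

  map-cong-local : ∀ {n} {h k : ℕ → ℕ} (ys : Vec ℕ n) → All (λ y → h y ≡ k y) ys → vmap h ys ≡ vmap k ys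
  map-cong-local [] [] = refl
  map-cong-local (y ∷ ys) (e ∷ es) = cong₂ _∷_ e (map-cong-local ys es)

  kinds : ∀ {n} (ys : Vec ℕ n) → oneComponent ys ≡ true → ∀ b → UA.inP (component ys) ≡ b →
          All (λ y → UA.inP (π₁ y) ≡ b) ys
  kinds ys one b ec = All.map (λ q → trans (cong UA.inP q) ec) (oneComponent-sound ys one)

  module FromEmbedding (f : ℕ → ℕ) (embF : IsEmbedding A B f) where
    private module F = IsEmbedding embF

    lift : ℕ → ℕ
    lift z = if UA.inP (π₁ z) then cantor 0 (f (π₂ z)) else z

    lift-inP : ∀ z → UA.inP (π₁ z) ≡ true → lift z ≡ cantor 0 (f (π₂ z))
    lift-inP z e = cong (λ b → if b then cantor 0 (f (π₂ z)) else z) e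

    lift-inQ : ∀ z → UA.inP (π₁ z) ≡ false → lift z ≡ z
    lift-inQ z e = cong (λ b → if b then cantor 0 (f (π₂ z)) else z) e

    π₁-lift : ∀ z → π₁ (lift z) ≡ π₁ z
    π₁-lift z with UA.inP (π₁ z) in e
    ... | true = trans (π₁-cantor 0 (f (π₂ z))) (sym (≡ᵇ-true e))
    ... | false = refl

    oneComponent-lift : ∀ {n} (ys : Vec ℕ n) → oneComponent (vmap lift ys) ≡ oneComponent ys
    oneComponent-lift = oneComponent-relabel lift (λ x → x) (λ a b → refl) π₁-lift

    seconds-lift-inP : ∀ {n} (ys : Vec ℕ n) → All (λ y → UA.inP (π₁ y) ≡ true) ys →
                       vmap π₂ (vmap lift ys) ≡ vmap f (vmap π₂ ys)
    seconds-lift-inP ys inp = trans (sym (map-∘ π₂ lift ys))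
      (trans (map-cong-local ys (All.map (λ {y} e → trans (cong π₂ (lift-inP y e)) (π₂-cantor 0 _)) inp))
             (map-∘ f π₂ ys))

    lift-inQ-all : ∀ {n} (ys : Vec ℕ n) → All (λ y → UA.inP (π₁ y) ≡ false) ys → vmap lift ys ≡ ys
    lift-inQ-all [] [] = refl
    lift-inQ-all (y ∷ ys) (e ∷ es) = cong₂ _∷_ (lift-inQ y e) (lift-inQ-all ys es)

    -- lift preserves the diagram: on component 0 because f is an embedding,
    -- elsewhere because lift is the identity there
    holds-lift : ∀ t r (ys : Vec ℕ (arity t r)) → All (λ a → UA.udom a ≡ true) ys →
                 UA.holds t r ys ≡ UB.holds t r (vmap lift ys)
    holds-lift zero r ys ds
      rewrite oneComponent-lift ys | if-same (UB.inP (component (vmap lift ys))) (B.Rel r (vmap π₂ (vmap lift ys)))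
      with isRel r in er | oneComponent ys in one
    ... | false | _ = refl
    ... | true | false = refl
    ... | true | true with UA.inP (component ys) in ec
    ... | true = trans (F.pres-rel r er (vmap π₂ ys) (UA.inside-P ys one ec ds))
                       (cong (B.Rel r) (sym (seconds-lift-inP ys (kinds ys one true ec))))
    ... | false = cong (B.Rel r) (cong (vmap π₂) (sym (lift-inQ-all ys (kinds ys one false ec))))
    holds-lift (suc zero) g (y ∷ xs) (d ∷ ds)
      rewrite oneComponent-lift (y ∷ xs) | if-same (UB.inP (π₁ (lift y))) (B.Fun g (vmap π₂ (vmap lift xs)))
      with isFun g in eg | oneComponent (y ∷ xs) in one
    ... | false | _ = refl
    ... | true | false = refl
    ... | true | true with UA.inP (π₁ y) in ey
    ... | true = sym (trans (cong₂ _≡ᵇ_ (π₂-cantor 0 (f (π₂ y)))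
                               (trans (cong (B.Fun g) (seconds-lift-inP xs (All.tail (kinds (y ∷ xs) one true ey))))
                                      (sym (F.pres-fun g eg (vmap π₂ xs) args))))
                        (≡ᵇ-injective f (π₂ y) (A.Fun g (vmap π₂ xs))
                           (F.injective _ _ d (A.Fun-closed g eg (vmap π₂ xs) args))))
      where
      args = UA.dom-component true A.dom (π₁ y) xs UA.dom-inP (All.tail (oneComponent-sound (y ∷ xs) one)) ey ds
    ... | false = cong (λ zs → π₂ y ≡ᵇ B.Fun g (vmap π₂ zs))
                    (sym (lift-inQ-all xs (All.tail (kinds (y ∷ xs) one false ey))))
    holds-lift (suc (suc zero)) _ (x ∷ y ∷ []) ds = sym (cong₂ _≡ᵇ_ (π₁-lift x) (π₁-lift y))
    holds-lift (suc (suc (suc _))) _ [] ds = refl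

    dom-lift : ∀ z → UA.udom z ≡ true → UB.udom (lift z) ≡ true
    dom-lift z d = by-kind (UA.inP (π₁ z)) refl
      where
      by-kind : ∀ b → UA.inP (π₁ z) ≡ b → UB.udom (lift z) ≡ true
      by-kind true e = trans (cong UB.udom (lift-inP z e)) (trans (UB.udom-inP _) (F.pres-dom _ (UA.dom-inP z e d)))
      by-kind false e = trans (cong UB.udom (lift-inQ z e)) (trans (if-same (UA.inP (π₁ z)) (B.dom (π₂ z))) (UA.dom-inQ z e d))

    injective-lift : ∀ z z' → UA.udom z ≡ true → UA.udom z' ≡ true → lift z ≡ lift z' → z ≡ z'
    injective-lift z z' d d' e = by-kind (UA.inP (π₁ z)) refl
      where
      same-component : π₁ z ≡ π₁ z'
      same-component = trans (sym (π₁-lift z)) (trans (cong π₁ e) (π₁-lift z'))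
      by-kind : ∀ b → UA.inP (π₁ z) ≡ b → z ≡ z'
      by-kind true ez = π-injective same-component
        (F.injective _ _ (UA.dom-inP z ez d) (UA.dom-inP z' ez' d') (trans (sym (π₂-cantor 0 _))
          (trans (cong π₂ (trans (sym (lift-inP z ez)) (trans e (lift-inP z' ez')))) (π₂-cantor 0 _))))
        where ez' = trans (cong UA.inP (sym same-component)) ez
      by-kind false ez = trans (sym (lift-inQ z ez)) (trans e (lift-inQ z' (trans (cong UA.inP (sym same-component)) ez)))

    lift-embedding : IsEmbedding UA.U UB.U lift
    lift-embedding = record
      { pres-dom = dom-lift
      ; injective = injective-lift
      ; pres-rel = λ s _ ys ds → holds-lift (π₁ s) (π₂ s) ys ds
      ; pres-fun = λ _ ()
      }

    -- the shift B ⊔ B ↪ A ⊔ B,  ⟨k, b⟩ ↦ ⟨k + 1, b⟩.  It needs f only for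
    -- the nullary relations, on which A and B must agree.
    shift : ℕ → ℕ
    shift z = cantor (suc (π₁ z)) (π₂ z)

    π₁-shift : ∀ z → π₁ (shift z) ≡ suc (π₁ z)
    π₁-shift z = π₁-cantor (suc (π₁ z)) (π₂ z)

    π₂-shift : ∀ z → π₂ (shift z) ≡ π₂ z
    π₂-shift z = π₂-cantor (suc (π₁ z)) (π₂ z)

    oneComponent-shift : ∀ {n} (ys : Vec ℕ n) → oneComponent (vmap shift ys) ≡ oneComponent ys
    oneComponent-shift = oneComponent-relabel shift suc (λ a b → refl) π₁-shift

    seconds-shift : ∀ {n} (ys : Vec ℕ n) → vmap π₂ (vmap shift ys) ≡ vmap π₂ ys
    seconds-shift ys = trans (sym (map-∘ π₂ shift ys)) (map-cong-local ys (All.universal π₂-shift ys))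

    udom-shift : ∀ z → UA.udom (shift z) ≡ B.dom (π₂ z)
    udom-shift z rewrite π₁-shift z | π₂-shift z = refl

    -- a shifted tuple lies in component 0 only if it is empty
    shift-inP-empty : ∀ {n} (ys : Vec ℕ n) → UA.inP (component (vmap shift ys)) ≡ true →
                      vmap f (vmap π₂ ys) ≡ vmap π₂ ys × All (λ a → A.dom a ≡ true) (vmap π₂ ys)
    shift-inP-empty [] e = refl , []
    shift-inP-empty (y ∷ ys) e rewrite π₁-shift y with e
    ... | ()

    -- the shift preserves the diagram: it relabels components injectively
    -- and never moves a nonempty tuple into component 0
    holds-shift : ∀ t r (ys : Vec ℕ (arity t r)) → UA.holds t r (vmap shift ys) ≡ UB.holds t r ys
    holds-shift zero r ys
      rewrite oneComponent-shift ys | seconds-shift ys | if-same (UB.inP (component ys)) (B.Rel r (vmap π₂ ys))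
      with isRel r in er | UA.inP (component (vmap shift ys)) in ec
    ... | false | _ = refl
    ... | true | false = refl
    ... | true | true with shift-inP-empty ys ec
    ... | fixed , inA = cong (oneComponent ys ∧_) (trans (F.pres-rel r er (vmap π₂ ys) inA) (cong (B.Rel r) fixed))
    holds-shift (suc zero) g (y ∷ xs)
      rewrite oneComponent-shift (y ∷ xs) | seconds-shift xs | if-same (UB.inP (π₁ y)) (B.Fun g (vmap π₂ xs))
            | π₁-shift y | π₂-shift y = refl
    holds-shift (suc (suc zero)) _ (x ∷ y ∷ []) rewrite π₁-shift x | π₁-shift y = refl
    holds-shift (suc (suc (suc _))) _ [] = refl

    shift-embedding : IsEmbedding UB.U UA.U shift
    shift-embedding = record
      { pres-dom = λ z d → trans (udom-shift z) (trans (sym (if-same (UB.inP (π₁ z)) (B.dom (π₂ z)))) d)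
      ; injective = λ z z' _ _ e → π-injective (suc-injective (trans (sym (π₁-shift z)) (trans (cong π₁ e) (π₁-shift z'))))
                                               (trans (sym (π₂-shift z)) (trans (cong π₂ e) (π₂-shift z')))
      ; pres-rel = λ s _ ys _ → sym (holds-shift (π₁ s) (π₂ s) ys)
      ; pres-fun = λ _ ()
      }

  -- Conversely, an embedding g : A ⊔ B ↪ B ⊔ B maps the copy of A into a
  -- single component (it preserves "same component"), which is a copy of B;
  -- second coordinates of g on the copy of A form an embedding A ↪ B.
  module Extract (g : ℕ → ℕ) (embG : IsEmbedding UA.U UB.U g) where
    private module G = IsEmbedding embG

    image : ℕ → ℕ
    image a = g (cantor 0 a)

    extract : ℕ → ℕ
    extract a = π₂ (image a)

    preserves : ∀ t r (ys : Vec ℕ (arity t r)) → All (λ a → UA.udom a ≡ true) ys →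
                UA.holds t r ys ≡ UB.holds t r (vmap g ys)
    preserves t r = at (cantor t r) (π₁-cantor t r) (π₂-cantor t r)
      where
      at : ∀ s {t r} → π₁ s ≡ t → π₂ s ≡ r → ∀ (ys : Vec ℕ (arity t r)) →
           All (λ a → UA.udom a ≡ true) ys → UA.holds t r ys ≡ UB.holds t r (vmap g ys)
      at s refl refl ys ds = G.pres-rel s refl ys ds

    inA : ∀ a → A.dom a ≡ true → UA.udom (cantor 0 a) ≡ true
    inA a da = trans (UA.udom-inP a) da

    inA-all : ∀ {n} (xs : Vec ℕ n) → All (λ a → A.dom a ≡ true) xs → All (λ a → UA.udom a ≡ true) (vmap (cantor 0) xs)
    inA-all [] [] = []
    inA-all (x ∷ xs) (d ∷ ds) = inA x d ∷ inA-all xs ds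

    same-component : ∀ a b → A.dom a ≡ true → A.dom b ≡ true → π₁ (image a) ≡ π₁ (image b)
    same-component a b da db = ≡ᵇ-true (trans (sym (preserves 2 0 (cantor 0 a ∷ cantor 0 b ∷ []) (inA a da ∷ inA b db ∷ [])))
                                              (cong₂ _≡ᵇ_ (π₁-cantor 0 a) (π₁-cantor 0 b)))

    image-oneComponent : ∀ {n} (xs : Vec ℕ n) → All (λ a → A.dom a ≡ true) xs → oneComponent (vmap image xs) ≡ true
    image-oneComponent [] [] = refl
    image-oneComponent (x ∷ xs) (d ∷ ds) =
      oneComponent-const (π₁ (image x)) (image x ∷ vmap image xs) (refl ∷ others xs ds)
      where
      others : ∀ {n} (xs : Vec ℕ n) → All (λ a → A.dom a ≡ true) xs → All (λ y → π₁ y ≡ π₁ (image x)) (vmap image xs)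
      others [] [] = []
      others (x' ∷ xs) (d' ∷ ds) = same-component x' x d' d ∷ others xs ds

    copyA-component : ∀ {n} (xs : Vec ℕ n) → All (λ y → π₁ y ≡ 0) (vmap (cantor 0) xs)
    copyA-component [] = []
    copyA-component (x ∷ xs) = π₁-cantor 0 x ∷ copyA-component xs

    component-zero : ∀ {n} (ys : Vec ℕ n) → All (λ y → π₁ y ≡ 0) ys → component ys ≡ 0
    component-zero [] [] = refl
    component-zero (y ∷ ys) (e ∷ es) = e

    seconds-copyA : ∀ {n} (xs : Vec ℕ n) → vmap π₂ (vmap (cantor 0) xs) ≡ xs
    seconds-copyA [] = refl
    seconds-copyA (x ∷ xs) = cong₂ _∷_ (π₂-cantor 0 x) (seconds-copyA xs)

    rel-copyA : ∀ r → isRel r ≡ true → (xs : Vec ℕ (rar r)) → UA.holds 0 r (vmap (cantor 0) xs) ≡ A.Rel r xs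
    rel-copyA r isR xs
      rewrite isR | oneComponent-const 0 (vmap (cantor 0) xs) (copyA-component xs)
            | component-zero (vmap (cantor 0) xs) (copyA-component xs) | seconds-copyA xs = refl

    rel-image : ∀ r → isRel r ≡ true → (xs : Vec ℕ (rar r)) → All (λ a → A.dom a ≡ true) xs →
                UB.holds 0 r (vmap g (vmap (cantor 0) xs)) ≡ B.Rel r (vmap extract xs)
    rel-image r isR xs ds
      rewrite sym (map-∘ g (cantor 0) xs) | isR | image-oneComponent xs ds
            | if-same (UB.inP (component (vmap image xs))) (B.Rel r (vmap π₂ (vmap image xs)))
            | sym (map-∘ π₂ image xs) = refl

    extract-rel : ∀ r → isRel r ≡ true → ∀ xs → All (λ a → A.dom a ≡ true) xs → A.Rel r xs ≡ B.Rel r (vmap extract xs)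
    extract-rel r isR xs ds = begin
      A.Rel r xs                               ≡⟨ sym (rel-copyA r isR xs) ⟩
      UA.holds 0 r (vmap (cantor 0) xs)         ≡⟨ preserves 0 r (vmap (cantor 0) xs) (inA-all xs ds) ⟩
      UB.holds 0 r (vmap g (vmap (cantor 0) xs)) ≡⟨ rel-image r isR xs ds ⟩
      B.Rel r (vmap extract xs)                 ∎
      where open ≡-Reasoning

    -- functions: the graph of h holds at ⟨0, h(xs)⟩, xs in A ⊔ B, hence at the
    -- image in B ⊔ B, which says  extract (h xs) = h (extract xs)  in B
    extract-fun : ∀ h → isFun h ≡ true → ∀ xs → All (λ a → A.dom a ≡ true) xs →
                  extract (A.Fun h xs) ≡ B.Fun h (vmap extract xs)
    extract-fun h isF xs ds =
      trans (≡ᵇ-true (proj₂ (proj₂ (∧-true₃ (isFun h) (oneComponent (vmap g ys)) _ image-graph))))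
            (cong (B.Fun h) (trans (cong (vmap π₂) (sym (map-∘ g (cantor 0) xs))) (sym (map-∘ π₂ image xs))))
      where
      y = A.Fun h xs
      ys = cantor 0 y ∷ vmap (cantor 0) xs
      graph : UA.holds 1 h ys ≡ true
      graph rewrite isF | oneComponent-const 0 ys (π₁-cantor 0 y ∷ copyA-component xs)
                  | π₁-cantor 0 y | π₂-cantor 0 y | seconds-copyA xs = ≡ᵇ-refl y
      image-graph : isFun h ∧ (oneComponent (vmap g ys) ∧ (π₂ (image y) ≡ᵇ B.Fun h (vmap π₂ (vmap g (vmap (cantor 0) xs))))) ≡ true
      image-graph = trans (cong (λ w → isFun h ∧ (oneComponent (vmap g ys) ∧ (π₂ (image y) ≡ᵇ w)))
                            (sym (if-same (UB.inP (π₁ (image y))) (B.Fun h (vmap π₂ (vmap g (vmap (cantor 0) xs)))))))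
                      (trans (sym (preserves 1 h ys (inA y (A.Fun-closed h isF xs ds) ∷ inA-all xs ds))) graph)

    -- injectivity: two elements with equal extracts have images in the same
    -- component, hence equal images
    extract-embedding : IsEmbedding A B extract
    extract-embedding = record
      { pres-dom = λ a da → trans (sym (if-same (UB.inP (π₁ (image a))) (B.dom (extract a)))) (G.pres-dom _ (inA a da))
      ; injective = λ a b da db e → trans (sym (π₂-cantor 0 a))
          (trans (cong π₂ (G.injective _ _ (inA a da) (inA b db) (π-injective (same-component a b da db) e))) (π₂-cantor 0 b))
      ; pres-rel = extract-rel
      ; pres-fun = extract-fun
      }

-- (6) The reduction for computable structures, and the theorem.

module Reduction (L : Language) (A B : CompStructure L) where

  open Symbols L
  open Pairing
  open import Data.Nat
  open import Data.Nat.Properties using (+-identityʳ)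
  open import Data.Bool using (true; false; not; if_then_else_)
  open import Data.Vec using ([]; _∷_)
  open import Relation.Binary.PropositionalEquality
  private
    As = CompStructure.struct A
    Bs = CompStructure.struct B
  open UnionEmbeddings L As Bs

  A⊔B : CompStructure L'
  A⊔B = record { struct = UA.U
               ; isComp = UnionComputable.U-computable L As Bs (CompStructure.isComp A) (CompStructure.isComp B) }

  B⊔B : CompStructure L'
  B⊔B = record { struct = UB.U
               ; isComp = UnionComputable.U-computable L Bs Bs (CompStructure.isComp B) (CompStructure.isComp B) }

  unions-bi-embeddable : ∀ X → A ↪[ X ] B → A⊔B ≈[ X ] B⊔B
  unions-bi-embeddable X (f , embF , e , ev-f) =
    (lift , lift-embedding , liftC , ev-lift) , (shift , shift-embedding , shiftC , λ z _ → ev-shift z)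
    where
    open FromEmbedding f embF
    open Programs X

    inPC : Code 1
    inPC = c2 eqC (π₁C ∘₁ p0) (cst 0)

    liftC : Code 1
    liftC = c2 add (grd inPC (c2 cantorC (cst 0) (e ∘₁ π₂C ∘₁ p0))) (grd (nsgC ∘₁ inPC) p0)

    ev-lift : ∀ z → UA.udom z ≡ true → Eval X liftC (z ∷ []) (lift z)
    ev-lift z d = ev-≡ (by-kind (UA.inP (π₁ z)) refl)
      (ap2 (ev-add _ _)
        (ev-grd (UA.inP (π₁ z)) inPE
           (λ inp → ap2 (ev-cantor _ _) (ev-cst 0) (ap1 (ev-f _ (UA.dom-inP z inp d)) (ap1 (ev-π₂ z) e-proj))))
        (ev-grd (not (UA.inP (π₁ z))) (ev-≡ (nsg-b2n _) (ap1 (ev-nsg _) inPE)) (λ _ → e-proj)))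
      where
      inPE = ap2 (ev-eq _ _) (ap1 (ev-π₁ z) e-proj) (ev-cst 0)
      by-kind : ∀ b → UA.inP (π₁ z) ≡ b →
                (if b then cantor 0 (f (π₂ z)) else 0) + (if not b then z else 0) ≡ lift z
      by-kind true eb = trans (+-identityʳ _) (sym (lift-inP z eb))
      by-kind false eb = sym (lift-inQ z eb)

    shiftC : Code 1
    shiftC = c2 cantorC (sc ∘₁ π₁C ∘₁ p0) (π₂C ∘₁ p0)

    ev-shift : ∀ z → Eval X shiftC (z ∷ []) (shift z)
    ev-shift z = ap2 (ev-cantor _ _) (ap1 e-sc (ap1 (ev-π₁ z) e-proj)) (ap1 (ev-π₂ z) e-proj)

  embedding-from-unions : ∀ Y → A⊔B ↪[ Y ] B⊔B → A ↪[ Y ] B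
  embedding-from-unions Y (g , embG , e , ev-g) =
    extract , extract-embedding , π₂C ∘₁ e ∘₁ c2 cantorC (cst 0) p0 ,
    λ a da → ap1 (ev-π₂ _) (ap1 (ev-g _ (inA a da)) (ap2 (ev-cantor _ _) (ev-cst 0) e-proj))
    where
    open Extract g embG
    open Programs Y

lowEmb⇒lowBiEmb : ∀ X → LowForEmbeddings X → LowForBiEmbeddings X
lowEmb⇒lowBiEmb X low L A B (A↪B , B↪A) = low L A B A↪B , low L B A B↪A

-- an X-computable A ↪ B gives A ⊔ B ≈_X B ⊔ B, hence A ⊔ B ≈_∅ B ⊔ B, hence
-- a computable A ↪ B
lowBiEmb⇒lowEmb : ∀ X → LowForBiEmbeddings X → LowForEmbeddings X
lowBiEmb⇒lowEmb X low L A B A↪B =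
  embedding-from-unions ∅ (proj₁ (low (L' L) A⊔B B⊔B (unions-bi-embeddable X A↪B)))
  where
  open Reduction L A B
  open Symbols using (L')

mainTheorem7 : ∀ (X : Oracle) →
    (LowForEmbeddings X → LowForBiEmbeddings X) × (LowForBiEmbeddings X → LowForEmbeddings X)
mainTheorem7 X = lowEmb⇒lowBiEmb X , lowBiEmb⇒lowEmb X
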